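{- There exists a $(\mathbb{Z}_{40},[1,3,9,27],20)$ Hadamard partitioned difference family, i.e. a partition of the cyclic group $\mathbb{Z}_{40}$ into four blocks of sizes $1,3,9,27$ whose lists of differences together cover every non-zero element of $\mathbb{Z}_{40}$ exactly $20$ times.
   Context: For a subset $B$ of an additive group $G$, the list of differences $\Delta B$ is the multiset $\{x-y: x,y\in B,\ x\neq y\}$. A $(G,[k_1,\dots,k_t],\lambda)$ partitioned difference family is a partition of $G$ into blocks $B_1,\dots,B_t$ with $|B_i|=k_i$ such that the multiset union of the $\Delta B_i$ covers every non-zero element of $G$ exactly $\lambda$ times; it is Hadamard if $|G|=2\lambda$. -}

module Defs where

open import Data.Nat using (ℕ; _+_; _∸_)
open import Data.Nat.DivMod using (_mod_)
open import Data.Nat.ListAction using (sum)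
open import Data.Fin using (Fin; toℕ; _≟_)
open import Data.Product using (_×_; _,_)
open import Data.List using (List; length; filter; cartesianProduct)
open import Data.Vec using (Vec; lookup)
open import Relation.Nullary using (¬_; Dec; yes; no; _×-dec_; ¬?)
open import Relation.Binary.PropositionalEquality using (_≡_)

_-ₙ_ : ∀ {n} → Fin (Data.Nat.suc n) → Fin (Data.Nat.suc n) → Fin (Data.Nat.suc n)
_-ₙ_ {n} x y = (toℕ x + Data.Nat.suc n ∸ toℕ y) mod (Data.Nat.suc n)

-- Multiplicity of g in the list of differences ΔB = {x - y : x,y ∈ B, x ≠ y}
-- (B given as a duplicate-free list, so ordered pairs of elements = ordered pairs of positions).
diffCount : ∀ {n} → List (Fin (Data.Nat.suc n)) → Fin (Data.Nat.suc n) → ℕ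
diffCount B g =
  length (filter (λ { (x , y) → ¬? (x ≟ y) ×-dec ((x -ₙ y) ≟ g) }) (cartesianProduct B B))

occ : ∀ {m t} → Vec (List (Fin m)) t → Fin m → ℕ
occ {t = t} Bs x = sum (Data.List.map (λ i → length (filter (λ y → y ≟ x) (lookup Bs i))) (Data.List.allFin t))

totalDiff : ∀ {n t} → Vec (List (Fin (Data.Nat.suc n))) t → Fin (Data.Nat.suc n) → ℕ
totalDiff {t = t} Bs g = sum (Data.List.map (λ i → diffCount (lookup Bs i) g) (Data.List.allFin t))

-- A (Z_{n+1}, [k_1,…,k_t], λ) partitioned difference family:
-- blocks B_i (as lists) with |B_i| = k_i, each element of Z_{n+1} occurring in
-- exactly one block exactly once (so the blocks partition the group), and every
-- non-zero g occurring exactly λ times in the union of the ΔB_i.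
record IsPDF (n t : ℕ) (ks : Vec ℕ t) (λ' : ℕ) (Bs : Vec (List (Fin (Data.Nat.suc n))) t) : Set where
  field
    sizes     : ∀ i → length (lookup Bs i) ≡ lookup ks i
    partition : ∀ x → occ Bs x ≡ 1
    diffs     : ∀ g → ¬ (g ≡ Data.Fin.zero) → totalDiff Bs g ≡ λ'

module Submission where

open import Defs
open import Data.Nat using (ℕ; suc)
open import Data.Fin using (Fin; #_)
open import Data.Fin.Properties using (all?)
open import Data.List using (List; []; _∷_; length)
open import Data.Vec using (Vec; _∷_; []; lookup)
open import Data.Product using (∃; _,_)
open import Relation.Nullary using (Dec; yes; no; ¬?)
open import Relation.Nullary.Decidable using (from-yes; _→-dec_)
import Data.Nat as ℕ
import Data.Fin as Fin

isPDF? : ∀ n t (ks : Vec ℕ t) λ' (Bs : Vec (List (Fin (suc n))) t) → Dec (IsPDF n t ks λ' Bs)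
isPDF? n t ks λ' Bs
  with all? (λ i → length (lookup Bs i) ℕ.≟ lookup ks i)
     | all? (λ x → occ Bs x ℕ.≟ 1)
     | all? (λ g → ¬? (g Fin.≟ Fin.zero) →-dec (totalDiff Bs g ℕ.≟ λ'))
... | yes sizes | yes partition | yes diffs = yes record { sizes = sizes ; partition = partition ; diffs = diffs }
... | no ¬sizes | _             | _         = no λ pdf → ¬sizes (IsPDF.sizes pdf)
... | yes _     | no ¬partition | _         = no λ pdf → ¬partition (IsPDF.partition pdf)
... | yes _     | yes _         | no ¬diffs = no λ pdf → ¬diffs (IsPDF.diffs pdf)

-- The first two blocks together with 0 form the subgroup ⟨10⟩; the third block
-- meets each of its nine non-trivial cosets exactly once.
hadamardBlocks : Vec (List (Fin 40)) 4
hadamardBlocks =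
  (# 0 ∷ []) ∷
  (# 10 ∷ # 20 ∷ # 30 ∷ []) ∷
  (# 1 ∷ # 9 ∷ # 2 ∷ # 18 ∷ # 13 ∷ # 37 ∷ # 15 ∷ # 16 ∷ # 24 ∷ []) ∷
  (# 3 ∷ # 27 ∷ # 4 ∷ # 36 ∷ # 5 ∷ # 6 ∷ # 14 ∷ # 7 ∷ # 23 ∷ # 8 ∷ # 32 ∷ # 11 ∷ # 19 ∷ # 12 ∷
   # 28 ∷ # 17 ∷ # 33 ∷ # 21 ∷ # 29 ∷ # 22 ∷ # 38 ∷ # 25 ∷ # 26 ∷ # 34 ∷ # 31 ∷ # 39 ∷ # 35 ∷ []) ∷
  []

mainTheorem11 : ∃ λ (Bs : Vec (List (Fin 40)) 4) → IsPDF 39 4 (1 ∷ 3 ∷ 9 ∷ 27 ∷ []) 20 Bs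
mainTheorem11 = hadamardBlocks , from-yes (isPDF? 39 4 (1 ∷ 3 ∷ 9 ∷ 27 ∷ []) 20 hadamardBlocks)
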